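{- Let $s,t\geq 2$ be integers and let $G$ be a (finite, simple) $r$-regular graph. Suppose $\mu$ is a non-main eigenvalue of $G$ and $X\subset V(G)$ is a star set for $\mu$ in $G$ such that the induced subgraph $H:=G-X$ is isomorphic to $K_s\nabla tK_1$. For $u\in X$, let $a=|N_G(u)\cap V(K_s)|$ be the number of neighbours of $u$ in the $K_s$ part of $H$. Then $$(t+\mu)a^2+(t+2\mu-2st-2s\mu+t\mu+2\mu^2)a+\mu-st-2s\mu+s^2t-2s\mu^2+s^2\mu+3\mu^2+3\mu^3+\mu^4-st\mu=0.$$
   Context: For a graph $G$ with adjacency matrix $A(G)$ and an eigenvalue $\mu$ of multiplicity $k$, a star set for $\mu$ in $G$ is a subset $X\subset V(G)$ with $|X|=k$ such that $\mu$ is not an eigenvalue of the induced subgraph $G-X$. An eigenvalue $\mu$ is non-main if its eigenspace is orthogonal to the all-ones vector. $K_s\nabla tK_1$ denotes the complete graph $K_s$ joined (every vertex to every vertex) to $t$ isolated vertices; $V(K_s)$ and $V(tK_1)$ denote the corresponding vertex subsets of $H$. -}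

module Defs where

open import Level using (0ℓ)
open import Data.Nat using (ℕ; zero; suc) renaming (_+_ to _+ℕ_)
open import Data.Fin using (Fin; zero; suc; splitAt; _≟_)
open import Data.Fin.Subset using (Subset; _∈_; _∉_; ∣_∣)
open import Data.Bool using (Bool; true; false; if_then_else_; not)
open import Data.Sum using (inj₁; inj₂)
open import Data.Product using (Σ; ∃; _×_; _,_)
open import Function using (_∘_; _⇔_)
open import Function.Definitions using (Injective)
open import Relation.Nullary using (¬_)
open import Relation.Nullary.Decidable using (⌊_⌋)
open import Relation.Binary.PropositionalEquality using (_≡_; _≢_)
open import Relation.Binary using (Rel)
open import Relation.Binary.Structures using (IsTotalOrder)
open import Algebra.Core using (Op₁; Op₂)
open import Algebra.Structures using (IsCommutativeRing)

-- The real numbers, axiomatised as a complete ordered field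
-- (these axioms determine ℝ up to isomorphism).

record RealField : Set₁ where
  infixl 6 _+_
  infixl 7 _*_
  infix  8 -_
  infix  4 _≤ᵣ_
  field
    Carrier : Set
    _+_ _*_ : Op₂ Carrier
    -_      : Op₁ Carrier
    0# 1#   : Carrier
    _⁻¹     : Op₁ Carrier
    _≤ᵣ_     : Rel Carrier 0ℓ
    isCommutativeRing : IsCommutativeRing _≡_ _+_ _*_ -_ 0# 1#
    0≢1          : 0# ≢ 1#
    ⁻¹-inverse   : ∀ x → x ≢ 0# → x * (x ⁻¹) ≡ 1#
    isTotalOrder : IsTotalOrder _≡_ _≤ᵣ_
    +-mono-≤     : ∀ {x y} z → x ≤ᵣ y → x + z ≤ᵣ y + z
    *-nonneg     : ∀ {x y} → 0# ≤ᵣ x → 0# ≤ᵣ y → 0# ≤ᵣ x * y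
    complete : (P : Carrier → Set) → ∃ P →
               (∃ λ b → ∀ x → P x → x ≤ᵣ b) →
               ∃ λ s → (∀ x → P x → x ≤ᵣ s) ×
                       (∀ b → (∀ x → P x → x ≤ᵣ b) → s ≤ᵣ b)

record Graph (n : ℕ) : Set where
  field
    adj    : Fin n → Fin n → Bool
    sym    : ∀ i j → adj i j ≡ adj j i
    irrefl : ∀ i → adj i i ≡ false
open Graph public

sumℕ : ∀ {n} → (Fin n → ℕ) → ℕ
sumℕ {zero}  f = 0
sumℕ {suc n} f = f zero +ℕ sumℕ (f ∘ suc)

indicator : Bool → ℕ
indicator b = if b then 1 else 0

degree : ∀ {n} → Graph n → Fin n → ℕ
degree G v = sumℕ (λ w → indicator (adj G v w))

Regular : ∀ {n} → Graph n → ℕ → Set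
Regular G r = ∀ v → degree G v ≡ r

induced : ∀ {n m} → Graph n → (Fin m → Fin n) → Graph m
induced G e = record
  { adj    = λ i j → adj G (e i) (e j)
  ; sym    = λ i j → sym G (e i) (e j)
  ; irrefl = λ i → irrefl G (e i)
  }

EnumeratesComplement : ∀ {n m} → Subset n → (Fin m → Fin n) → Set
EnumeratesComplement {n} X e =
  Injective _≡_ _≡_ e × (∀ (v : Fin n) → (v ∉ X) ⇔ (∃ λ i → e i ≡ v))

-- adjacency of K_s ∇ tK_1 on Fin (s + t): the first s vertices form K_s,
-- the last t vertices are the isolated part tK_1
joinAdj : (s t : ℕ) → Fin (s +ℕ t) → Fin (s +ℕ t) → Bool
joinAdj s t i j with splitAt s i | splitAt s j
... | inj₁ a | inj₁ b = not ⌊ a ≟ b ⌋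
... | inj₁ _ | inj₂ _ = true
... | inj₂ _ | inj₁ _ = true
... | inj₂ _ | inj₂ _ = false

IsIsoOnto : ∀ {n m} → Graph n → (Fin m → Fin n) → (Fin m → Fin m → Bool) → Set
IsIsoOnto G e K = ∀ i j → adj G (e i) (e j) ≡ K i j

module Spectral (ℝ : RealField) where
  open RealField ℝ public

  _-_ : Carrier → Carrier → Carrier
  x - y = x + (- y)
  infixl 6 _-_

  Σ[_] : ∀ {n} → (Fin n → Carrier) → Carrier
  Σ[_] {zero}  f = 0#
  Σ[_] {suc n} f = f zero + Σ[ f ∘ suc ]

  ι : ℕ → Carrier
  ι zero    = 0#
  ι (suc k) = 1# + ι k

  A : ∀ {n} → Graph n → Fin n → Fin n → Carrier
  A G i j = if adj G i j then 1# else 0#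

  IsEigenvector : ∀ {n} → Graph n → Carrier → (Fin n → Carrier) → Set
  IsEigenvector G μ v = ∀ i → Σ[ (λ j → A G i j * v j) ] ≡ μ * v i

  IsEigenvalue : ∀ {n} → Graph n → Carrier → Set
  IsEigenvalue G μ = ∃ λ v → IsEigenvector G μ v × ∃ λ i → v i ≢ 0#

  -- μ has multiplicity k: the eigenspace of μ has dimension k
  -- (for the real symmetric A(G) this equals the algebraic multiplicity)
  Multiplicity : ∀ {n} → Graph n → Carrier → ℕ → Set
  Multiplicity {n} G μ k =
    ∃ λ (b : Fin k → Fin n → Carrier) →
      (∀ l → IsEigenvector G μ (b l)) ×
      (∀ (c : Fin k → Carrier) →
         (∀ i → Σ[ (λ l → c l * b l i) ] ≡ 0#) → ∀ l → c l ≡ 0#) ×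
      (∀ v → IsEigenvector G μ v →
         ∃ λ (c : Fin k → Carrier) → ∀ i → v i ≡ Σ[ (λ l → c l * b l i) ])

  NonMain : ∀ {n} → Graph n → Carrier → Set
  NonMain G μ = IsEigenvalue G μ × (∀ v → IsEigenvector G μ v → Σ[ v ] ≡ 0#)

  IsStarSet : ∀ {n} → Graph n → Carrier → Subset n → Set
  IsStarSet {n} G μ X =
    Multiplicity G μ ∣ X ∣ ×
    (∀ m (e : Fin m → Fin n) → EnumeratesComplement X e →
       ¬ IsEigenvalue (induced G e) μ)

module Submission where

-- Let y be the μ-eigenvector of
-- G that is 1 at u ∈ X and 0 on the rest of the star set X; it exists
-- because restriction to the coordinates in X is an isomorphism from the
-- μ-eigenspace onto Carrierˣ (a μ-eigenvector vanishing on X would give an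
-- eigenvector of G - X).  The eigen-equations of y at the vertices of
-- H = G - X and at u, summed over the clique and the coclique of H (plainly
-- and weighted by adjacency to u), together with Σ y = 0 (μ is non-main)
-- and μ ≠ -1 (-1 is an eigenvalue of H since s ≥ 2), leave a system whose
-- elimination yields the stated quadratic in a.
--
-- The reals are only an axiomatised ordered field here, so we argue
-- constructively: existence of y is obtained under double negation, by
-- Gaussian elimination, and the conclusion, an equation, is recovered since
-- equality of reals is ¬¬-stable (a consequence of completeness).

open import Defs hiding (sym)
open import Level using (0ℓ)
open import Data.Bool using (Bool; true; false; if_then_else_)
open import Data.Fin using (Fin; zero; suc; _≟_; _↑ˡ_; _↑ʳ_; splitAt; join)
open import Data.Fin.Properties using (any?; suc-injective; 0≢1+n; splitAt-↑ˡ; splitAt-↑ʳ; join-splitAt)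
open import Data.Fin.Subset using (Subset; _∈_; _∉_; ∣_∣) renaming (_-_ to _∖_)
open import Data.Fin.Subset.Properties using (_∈?_; x∈p⇒∣p-x∣<∣p∣; x∈p∧x∉q⇒x∈p─q; x≢y⇒x∉⁅y⁆)
open import Data.Integer as ℤ using (ℤ; -[1+_]; _⊖_)
import Data.Integer.Properties as ℤ
open import Data.Maybe using (Maybe; just; nothing)
open import Data.Nat using (ℕ; zero; suc; _≤_; z≤n; s≤s) renaming (_+_ to _+ℕ_; _*_ to _*ℕ_)
import Data.Nat.Properties as ℕ
open import Data.Product using (Σ; ∃; _×_; _,_; proj₁; proj₂)
open import Data.Sum using (inj₁; inj₂; [_,_]′)
open import Data.Vec.Functional using (_∷_)
open import Function using (_∘_; Equivalence)
open import Function.Definitions using (Injective)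
open import Relation.Nullary using (¬_; yes; no; does; contradiction)
open import Relation.Binary.PropositionalEquality
  using (_≡_; _≢_; refl; sym; trans; cong; cong₂; subst; subst₂; module ≡-Reasoning)
open import Relation.Binary.Structures using (IsTotalOrder)
open import Algebra.Bundles using (CommutativeRing)
open import Algebra.Solver.Ring.AlmostCommutativeRing
  using (_-Raw-AlmostCommutative⟶_; fromCommutativeRing)

injection-bound : ∀ {j n} (X : Subset n) (p : Fin j → Fin n) →
                  Injective _≡_ _≡_ p → (∀ i → p i ∈ X) → j ≤ ∣ X ∣
injection-bound {zero}  X p inj p∈X = z≤n
injection-bound {suc j} X p inj p∈X =
  ℕ.≤-trans (s≤s (injection-bound (X ∖ p zero) (p ∘ suc) (suc-injective ∘ inj) p∘suc∈X′))
            (x∈p⇒∣p-x∣<∣p∣ (p∈X zero))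
  where
  p∘suc∈X′ : ∀ i → p (suc i) ∈ X ∖ p zero
  p∘suc∈X′ i = x∈p∧x∉q⇒x∈p─q (p∈X (suc i)) (x≢y⇒x∉⁅y⁆ (λ eq → 0≢1+n (sym (inj eq))))

-- Pigeonhole in the other direction: an injection of Fin ∣ X ∣ into X hits
-- every element of X (otherwise it extends to an injection of Fin (1 + ∣ X ∣)).
injection-onto : ∀ {n} (X : Subset n) (p : Fin ∣ X ∣ → Fin n) →
                 Injective _≡_ _≡_ p → (∀ i → p i ∈ X) →
                 ∀ u → u ∈ X → ∃ λ a → p a ≡ u
injection-onto X p inj p∈X u u∈X with any? (λ a → p a ≟ u)
... | yes hit = hit
... | no miss = contradiction (injection-bound X (u ∷ p) inj⁺ p⁺∈X) (ℕ.n≮n ∣ X ∣)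
  where
  inj⁺ : Injective _≡_ _≡_ (u ∷ p)
  inj⁺ {zero}  {zero}  _  = refl
  inj⁺ {zero}  {suc b} eq = contradiction (b , sym eq) miss
  inj⁺ {suc a} {zero}  eq = contradiction (a , eq) miss
  inj⁺ {suc a} {suc b} eq = cong suc (inj eq)
  p⁺∈X : ∀ i → (u ∷ p) i ∈ X
  p⁺∈X zero    = u∈X
  p⁺∈X (suc i) = p∈X i

-- The canonical map ℤ → R into a commutative ring R is a ring morphism;
-- hence the standard ring solver with integer coefficients proves
-- polynomial identities in R.
module IntegerCoefficients {a ℓ} (R : CommutativeRing a ℓ) where

  open import Data.Integer using (+_)
  open CommutativeRing R renaming (refl to ≈-refl; sym to ≈-sym; trans to ≈-trans)
  open import Algebra.Properties.Semiring.Mult.TCOptimised semiring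
    using (×-homo-+; ×1-homo-*; 1+×) renaming (_×_ to _×ᴿ_)
  open import Algebra.Properties.Ring ring using (-‿distribˡ-*; -‿distribʳ-*; -0#≈0#)
  open import Algebra.Properties.AbelianGroup +-abelianGroup using (⁻¹-involutive; ⁻¹-∙-comm)
  open import Relation.Binary.Reasoning.Setoid setoid

  -- Natural numbers are sent to sums of 1#, with 1 ↦ 1# on the nose.
  ⟦_⟧ℕ : ℕ → Carrier
  ⟦ n ⟧ℕ = n ×ᴿ 1#

  ⟦_⟧ℤ : ℤ → Carrier
  ⟦ + n ⟧ℤ      = ⟦ n ⟧ℕ
  ⟦ -[1+ n ] ⟧ℤ = - ⟦ suc n ⟧ℕ

  ⟦⟧ℤ-cong : ∀ {i j} → i ≡ j → ⟦ i ⟧ℤ ≈ ⟦ j ⟧ℤ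
  ⟦⟧ℤ-cong refl = ≈-refl

  -‿homo : ∀ i → ⟦ ℤ.- i ⟧ℤ ≈ - ⟦ i ⟧ℤ
  -‿homo (+ zero)  = ≈-sym -0#≈0#
  -‿homo (+ suc n) = ≈-refl
  -‿homo -[1+ n ]  = ≈-sym (⁻¹-involutive _)

  1+-cancel : ∀ x y → (1# + x) - (1# + y) ≈ x - y
  1+-cancel x y = begin
    (1# + x) - (1# + y)   ≈⟨ +-congˡ (⁻¹-∙-comm 1# y) ⟨
    (1# + x) + (- 1# - y) ≈⟨ +-assoc 1# x _ ⟩
    1# + (x + (- 1# - y)) ≈⟨ +-congˡ (+-assoc x (- 1#) (- y)) ⟨
    1# + ((x - 1#) - y)   ≈⟨ +-congˡ (+-congʳ (+-comm x (- 1#))) ⟩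
    1# + ((- 1# + x) - y) ≈⟨ +-congˡ (+-assoc (- 1#) x (- y)) ⟩
    1# + (- 1# + (x - y)) ≈⟨ +-assoc 1# (- 1#) _ ⟨
    (1# - 1#) + (x - y)   ≈⟨ +-congʳ (-‿inverseʳ 1#) ⟩
    0# + (x - y)          ≈⟨ +-identityˡ _ ⟩
    x - y                 ∎

  ⊖-homo : ∀ m n → ⟦ m ⊖ n ⟧ℤ ≈ ⟦ m ⟧ℕ - ⟦ n ⟧ℕ
  ⊖-homo m zero = begin
    ⟦ m ⊖ 0 ⟧ℤ    ≈⟨ ⟦⟧ℤ-cong (ℤ.⊖-≥ {m} {0} z≤n) ⟩
    ⟦ m ⟧ℕ        ≈⟨ +-identityʳ _ ⟨
    ⟦ m ⟧ℕ + 0#   ≈⟨ +-congˡ -0#≈0# ⟨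
    ⟦ m ⟧ℕ - 0#   ∎
  ⊖-homo zero (suc n) = begin
    ⟦ 0 ⊖ suc n ⟧ℤ    ≈⟨ ⟦⟧ℤ-cong (ℤ.⊖-< {0} {suc n} (s≤s z≤n)) ⟩
    - ⟦ suc n ⟧ℕ      ≈⟨ +-identityˡ _ ⟨
    0# - ⟦ suc n ⟧ℕ   ∎
  ⊖-homo (suc m) (suc n) = begin
    ⟦ suc m ⊖ suc n ⟧ℤ            ≈⟨ ⟦⟧ℤ-cong (ℤ.[1+m]⊖[1+n]≡m⊖n m n) ⟩
    ⟦ m ⊖ n ⟧ℤ                    ≈⟨ ⊖-homo m n ⟩
    ⟦ m ⟧ℕ - ⟦ n ⟧ℕ               ≈⟨ 1+-cancel _ _ ⟨
    (1# + ⟦ m ⟧ℕ) - (1# + ⟦ n ⟧ℕ) ≈⟨ +-cong (1+× m 1#) (-‿cong (1+× n 1#)) ⟨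
    ⟦ suc m ⟧ℕ - ⟦ suc n ⟧ℕ       ∎

  +-homo : ∀ i j → ⟦ i ℤ.+ j ⟧ℤ ≈ ⟦ i ⟧ℤ + ⟦ j ⟧ℤ
  +-homo (+ m)    (+ n)    = ×-homo-+ 1# m n
  +-homo (+ m)    -[1+ n ] = ⊖-homo m (suc n)
  +-homo -[1+ m ] (+ n)    = ≈-trans (⊖-homo n (suc m)) (+-comm _ _)
  +-homo -[1+ m ] -[1+ n ] = begin
    - ⟦ suc (suc (m +ℕ n)) ⟧ℕ     ≈⟨ ⟦⟧ℤ-cong (cong (λ k → -[1+ k ]) (ℕ.+-suc m n)) ⟨
    - ⟦ suc m +ℕ suc n ⟧ℕ         ≈⟨ -‿cong (×-homo-+ 1# (suc m) (suc n)) ⟩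
    - (⟦ suc m ⟧ℕ + ⟦ suc n ⟧ℕ)   ≈⟨ ⁻¹-∙-comm _ _ ⟨
    - ⟦ suc m ⟧ℕ + - ⟦ suc n ⟧ℕ   ∎

  +*-homo : ∀ m j → ⟦ + m ℤ.* j ⟧ℤ ≈ ⟦ m ⟧ℕ * ⟦ j ⟧ℤ
  +*-homo m (+ n) = begin
    ⟦ + m ℤ.* + n ⟧ℤ     ≈⟨ ⟦⟧ℤ-cong (ℤ.pos-* m n) ⟨
    ⟦ m *ℕ n ⟧ℕ          ≈⟨ ×1-homo-* m n ⟩
    ⟦ m ⟧ℕ * ⟦ n ⟧ℕ      ∎
  +*-homo m -[1+ n ] = begin
    ⟦ + m ℤ.* ℤ.- + suc n ⟧ℤ      ≈⟨ ⟦⟧ℤ-cong (ℤ.neg-distribʳ-* (+ m) (+ suc n)) ⟨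
    ⟦ ℤ.- (+ m ℤ.* + suc n) ⟧ℤ    ≈⟨ -‿homo (+ m ℤ.* + suc n) ⟩
    - ⟦ + m ℤ.* + suc n ⟧ℤ        ≈⟨ -‿cong (+*-homo m (+ suc n)) ⟩
    - (⟦ m ⟧ℕ * ⟦ suc n ⟧ℕ)       ≈⟨ -‿distribʳ-* _ _ ⟩
    ⟦ m ⟧ℕ * - ⟦ suc n ⟧ℕ         ∎

  *-homo : ∀ i j → ⟦ i ℤ.* j ⟧ℤ ≈ ⟦ i ⟧ℤ * ⟦ j ⟧ℤ
  *-homo (+ m)    j = +*-homo m j
  *-homo -[1+ m ] j = begin
    ⟦ ℤ.- + suc m ℤ.* j ⟧ℤ        ≈⟨ ⟦⟧ℤ-cong (ℤ.neg-distribˡ-* (+ suc m) j) ⟨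
    ⟦ ℤ.- (+ suc m ℤ.* j) ⟧ℤ      ≈⟨ -‿homo (+ suc m ℤ.* j) ⟩
    - ⟦ + suc m ℤ.* j ⟧ℤ          ≈⟨ -‿cong (+*-homo (suc m) j) ⟩
    - (⟦ suc m ⟧ℕ * ⟦ j ⟧ℤ)       ≈⟨ -‿distribˡ-* _ _ ⟩
    - ⟦ suc m ⟧ℕ * ⟦ j ⟧ℤ         ∎

  morphism : CommutativeRing.rawRing ℤ.+-*-commutativeRing -Raw-AlmostCommutative⟶
             fromCommutativeRing R
  morphism = record
    { ⟦_⟧    = ⟦_⟧ℤ
    ; +-homo = +-homo
    ; *-homo = *-homo
    ; -‿homo = -‿homo
    ; 0-homo = ≈-refl
    ; 1-homo = ≈-refl
    }

  coefficient≟ : ∀ i j → Maybe (⟦ i ⟧ℤ ≈ ⟦ j ⟧ℤ)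
  coefficient≟ i j with i ℤ.≟ j
  ... | yes i≡j = just (⟦⟧ℤ-cong i≡j)
  ... | no _    = nothing

  open import Algebra.Solver.Ring _ _ morphism coefficient≟ public
    using (solve; _:=_; _:+_; _:*_; :-_; _:-_; con) renaming (Polynomial to Poly)

module Theory (ℝ : RealField) where
  open Spectral ℝ
  open IsTotalOrder isTotalOrder using (total; antisym)
  open ≡-Reasoning

  commutativeRing : CommutativeRing 0ℓ 0ℓ
  commutativeRing = record { isCommutativeRing = isCommutativeRing }
  module R = CommutativeRing commutativeRing
  open IntegerCoefficients commutativeRing
  open import Algebra.Properties.CommutativeMonoid.Sum R.+-commutativeMonoid using (sum; ∑-distrib-+; ∑-comm)
  open import Algebra.Properties.Semiring.Sum R.semiring using (*-distribˡ-sum)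
  open import Algebra.Properties.Ring R.ring using (-‿distribˡ-*; -0#≈0#)
  open import Algebra.Properties.AbelianGroup R.+-abelianGroup using (⁻¹-∙-comm)

  𝟘 𝟙 : ∀ {k} → Poly k
  𝟘 = con (ℤ.+ 0)
  𝟙 = con (ℤ.+ 1)

  -- Squares are nonnegative, so 0 ≤ 1.
  0≤1 : 0# ≤ᵣ 1#
  0≤1 with total 0# 1#
  ... | inj₁ 0≤1 = 0≤1
  ... | inj₂ 1≤0 = subst (0# ≤ᵣ_) (solve 0 (:- 𝟙 :* :- 𝟙 := 𝟙) refl) (*-nonneg 0≤-1 0≤-1)
    where
    0≤-1 : 0# ≤ᵣ - 1#
    0≤-1 = subst₂ _≤ᵣ_ (R.-‿inverseʳ 1#) (R.+-identityˡ _) (+-mono-≤ (- 1#) 1≤0)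

  ¬1≤0 : ¬ (1# ≤ᵣ 0#)
  ¬1≤0 1≤0 = 0≢1 (sym (antisym 1≤0 0≤1))

  -- An Archimedean consequence of completeness: if y cannot be nonzero then
  -- y ≤ 0.  Indeed all multiples k·y are then ≤ 1; their supremum s is
  -- also bounded by s - y, whence y ≤ 0.
  ≤0-if-¬¬≡0 : ∀ y → ¬ ¬ (y ≡ 0#) → y ≤ᵣ 0#
  ≤0-if-¬¬≡0 y ¬¬y≡0 =
    subst₂ _≤ᵣ_ (solve 2 (λ s y → s :+ (y :- s) := y) refl s y)
                (solve 2 (λ s y → (s :- y) :+ (y :- s) := 𝟘) refl s y)
                (+-mono-≤ (y - s) s≤s-y)
    where
    Multiple : Carrier → Set
    Multiple x = ∃ λ k → x ≡ ι k * y
    multiple≤1 : ∀ x → Multiple x → x ≤ᵣ 1#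
    multiple≤1 x (k , x≡ky) with total x 1#
    ... | inj₁ x≤1 = x≤1
    ... | inj₂ 1≤x = contradiction (λ y≡0 → ¬1≤0 (subst (1# ≤ᵣ_) (x≡0 y≡0) 1≤x)) ¬¬y≡0
      where
      x≡0 : y ≡ 0# → x ≡ 0#
      x≡0 y≡0 = trans x≡ky (trans (cong (ι k *_) y≡0) (R.zeroʳ _))
    sup = complete Multiple (ι 0 * y , 0 , refl) (1# , multiple≤1)
    s = proj₁ sup
    s-y-bound : ∀ x → Multiple x → x ≤ᵣ s - y
    s-y-bound x (k , x≡ky) =
      subst (_≤ᵣ s - y) (trans (solve 2 (λ K y → (𝟙 :+ K) :* y :- y := K :* y) refl (ι k) y) (sym x≡ky))
            (+-mono-≤ (- y) (proj₁ (proj₂ sup) (ι (suc k) * y) (suc k , refl)))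
    s≤s-y : s ≤ᵣ s - y
    s≤s-y = proj₂ (proj₂ sup) (s - y) s-y-bound

  ≡-stable : ∀ {x y} → ¬ ¬ (x ≡ y) → x ≡ y
  ≡-stable {x} {y} ¬¬x≡y = begin
    x             ≡⟨ solve 2 (λ x y → x := (x :- y) :+ y) refl x y ⟩
    (x - y) + y   ≡⟨ cong (_+ y) (antisym (≤0-if-¬¬≡0 (x - y) ¬¬x-y≡0) 0≤x-y) ⟩
    0# + y        ≡⟨ R.+-identityˡ y ⟩
    y             ∎
    where
    ¬¬x-y≡0 : ¬ ¬ (x - y ≡ 0#)
    ¬¬x-y≡0 k = ¬¬x≡y (λ x≡y → k (trans (cong (_- y) x≡y) (R.-‿inverseʳ y)))
    ¬¬y-x≡0 : ¬ ¬ (y - x ≡ 0#)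
    ¬¬y-x≡0 k = ¬¬x≡y (λ x≡y → k (trans (cong (λ z → y - z) x≡y) (R.-‿inverseʳ y)))
    0≤x-y : 0# ≤ᵣ x - y
    0≤x-y = subst₂ _≤ᵣ_ (solve 2 (λ x y → (y :- x) :+ (x :- y) := 𝟘) refl x y)
                        (solve 2 (λ x y → 𝟘 :+ (x :- y) := x :- y) refl x y)
                        (+-mono-≤ (x - y) (≤0-if-¬¬≡0 (y - x) ¬¬y-x≡0))

  -- Finite sums.  The library's `sum` is the same recursion as Σ[_]; we
  -- borrow its algebraic laws through Σ≡sum.

  Σ≡sum : ∀ {n} (f : Fin n → Carrier) → Σ[ f ] ≡ sum f
  Σ≡sum {zero}  f = refl
  Σ≡sum {suc n} f = cong (f zero +_) (Σ≡sum (f ∘ suc))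

  Σ-cong : ∀ {n} {f g : Fin n → Carrier} → (∀ i → f i ≡ g i) → Σ[ f ] ≡ Σ[ g ]
  Σ-cong {zero}  f≗g = refl
  Σ-cong {suc n} f≗g = cong₂ _+_ (f≗g zero) (Σ-cong (f≗g ∘ suc))

  Σ-zero : ∀ {n} (f : Fin n → Carrier) → (∀ i → f i ≡ 0#) → Σ[ f ] ≡ 0#
  Σ-zero {zero}  f f≗0 = refl
  Σ-zero {suc n} f f≗0 = trans (cong₂ _+_ (f≗0 zero) (Σ-zero (f ∘ suc) (f≗0 ∘ suc))) (R.+-identityˡ 0#)

  Σ-+ : ∀ {n} (f g : Fin n → Carrier) → Σ[ (λ i → f i + g i) ] ≡ Σ[ f ] + Σ[ g ]
  Σ-+ f g = begin
    Σ[ (λ i → f i + g i) ]  ≡⟨ Σ≡sum (λ i → f i + g i) ⟩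
    sum (λ i → f i + g i)   ≡⟨ ∑-distrib-+ f g ⟩
    sum f + sum g           ≡⟨ sym (cong₂ _+_ (Σ≡sum f) (Σ≡sum g)) ⟩
    Σ[ f ] + Σ[ g ]         ∎

  Σ-*ˡ : ∀ {n} (x : Carrier) (f : Fin n → Carrier) → Σ[ (λ i → x * f i) ] ≡ x * Σ[ f ]
  Σ-*ˡ x f = begin
    Σ[ (λ i → x * f i) ]  ≡⟨ Σ≡sum (λ i → x * f i) ⟩
    sum (λ i → x * f i)   ≡⟨ sym (*-distribˡ-sum x f) ⟩
    x * sum f             ≡⟨ sym (cong (x *_) (Σ≡sum f)) ⟩
    x * Σ[ f ]            ∎

  Σ-*ʳ : ∀ {n} (x : Carrier) (f : Fin n → Carrier) → Σ[ (λ i → f i * x) ] ≡ Σ[ f ] * x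
  Σ-*ʳ x f = trans (Σ-cong (λ i → R.*-comm (f i) x)) (trans (Σ-*ˡ x f) (R.*-comm x _))

  Σ-neg : ∀ {n} (f : Fin n → Carrier) → Σ[ (λ i → - f i) ] ≡ - Σ[ f ]
  Σ-neg {zero}  f = sym -0#≈0#
  Σ-neg {suc n} f = trans (cong (- f zero +_) (Σ-neg (f ∘ suc))) (⁻¹-∙-comm _ _)

  Σ-const : ∀ n (x : Carrier) → Σ[ (λ (_ : Fin n) → x) ] ≡ ι n * x
  Σ-const zero    x = sym (R.zeroˡ x)
  Σ-const (suc n) x = trans (cong (x +_) (Σ-const n x))
                            (solve 2 (λ x k → x :+ k :* x := (𝟙 :+ k) :* x) refl x (ι n))

  Σ-swap : ∀ {m n} (f : Fin m → Fin n → Carrier) →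
           Σ[ (λ i → Σ[ f i ]) ] ≡ Σ[ (λ j → Σ[ (λ i → f i j) ]) ]
  Σ-swap f = begin
    Σ[ (λ i → Σ[ f i ]) ]                 ≡⟨ Σ≡sum² f ⟩
    sum (λ i → sum (f i))                 ≡⟨ ∑-comm f ⟩
    sum (λ j → sum (λ i → f i j))         ≡⟨ sym (Σ≡sum² (λ j i → f i j)) ⟩
    Σ[ (λ j → Σ[ (λ i → f i j) ]) ]       ∎
    where
    Σ≡sum² : ∀ {m n} (g : Fin m → Fin n → Carrier) → Σ[ (λ i → Σ[ g i ]) ] ≡ sum (λ i → sum (g i))
    Σ≡sum² g = trans (Σ-cong (λ i → Σ≡sum (g i))) (Σ≡sum (λ i → sum (g i)))

  Σ-split : ∀ s {t} (f : Fin (s +ℕ t) → Carrier) →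
            Σ[ f ] ≡ Σ[ (λ a → f (a ↑ˡ t)) ] + Σ[ (λ b → f (s ↑ʳ b)) ]
  Σ-split zero    f = sym (R.+-identityˡ _)
  Σ-split (suc s) f = trans (cong (f zero +_) (Σ-split s (f ∘ suc))) (sym (R.+-assoc _ _ _))

  deleteAt : ∀ {n} → Fin n → (Fin n → Carrier) → Fin n → Carrier
  deleteAt v f w = if does (v ≟ w) then 0# else f w

  Σ-deleteAt : ∀ {n} (v : Fin n) (f : Fin n → Carrier) → Σ[ f ] ≡ f v + Σ[ deleteAt v f ]
  Σ-deleteAt zero    f = cong (f zero +_) (sym (R.+-identityˡ _))
  Σ-deleteAt (suc v) f = trans (cong (f zero +_) (Σ-deleteAt v (f ∘ suc)))
    (solve 3 (λ a b c → a :+ (b :+ c) := b :+ (a :+ c)) refl (f zero) (f (suc v)) _)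

  Σ-image : ∀ {m n} (e : Fin m → Fin n) → Injective _≡_ _≡_ e → (g : Fin n → Carrier) →
            (∀ w → (∀ i → e i ≢ w) → g w ≡ 0#) → Σ[ g ] ≡ Σ[ g ∘ e ]
  Σ-image {zero}  e inj g g≡0 = Σ-zero g (λ w → g≡0 w (λ ()))
  Σ-image {suc m} e inj g g≡0 = begin
    Σ[ g ]                                    ≡⟨ Σ-deleteAt (e zero) g ⟩
    g (e zero) + Σ[ g′ ]                      ≡⟨ cong (g (e zero) +_) (Σ-image (e ∘ suc) (suc-injective ∘ inj) g′ g′≡0) ⟩
    g (e zero) + Σ[ g′ ∘ e ∘ suc ]            ≡⟨ cong (g (e zero) +_) (Σ-cong g′∘e∘suc) ⟩
    g (e zero) + Σ[ g ∘ e ∘ suc ]             ∎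
    where
    g′ = deleteAt (e zero) g
    g′≡0 : ∀ w → (∀ i → e (suc i) ≢ w) → g′ w ≡ 0#
    g′≡0 w w∉e∘suc with e zero ≟ w
    ... | yes _   = refl
    ... | no e0≢w = g≡0 w λ { zero → e0≢w ; (suc i) → w∉e∘suc i }
    g′∘e∘suc : ∀ i → g′ (e (suc i)) ≡ g (e (suc i))
    g′∘e∘suc i with e zero ≟ e (suc i)
    ... | yes eq = contradiction (inj eq) 0≢1+n
    ... | no _   = refl

  δ : ∀ {n} → Fin n → Fin n → Carrier
  δ a b = if does (a ≟ b) then 1# else 0#

  δ-refl : ∀ {n} (b : Fin n) → δ b b ≡ 1#
  δ-refl b with b ≟ b
  ... | yes _   = refl
  ... | no b≢b = contradiction refl b≢b

  δ-≢ : ∀ {n} {a b : Fin n} → a ≢ b → δ a b ≡ 0#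
  δ-≢ {a = a} {b} a≢b with a ≟ b
  ... | yes a≡b = contradiction a≡b a≢b
  ... | no _    = refl

  Σ-δ : ∀ {n} (f : Fin n → Carrier) (b : Fin n) → Σ[ (λ a → f a * δ a b) ] ≡ f b
  Σ-δ f b = begin
    Σ[ (λ a → f a * δ a b) ]                          ≡⟨ Σ-deleteAt b _ ⟩
    f b * δ b b + Σ[ deleteAt b (λ a → f a * δ a b) ] ≡⟨ cong₂ _+_ (cong (f b *_) (δ-refl b)) (Σ-zero _ off-b) ⟩
    f b * 1# + 0#                                     ≡⟨ solve 1 (λ x → x :* 𝟙 :+ 𝟘 := x) refl (f b) ⟩
    f b                                               ∎
    where
    off-b : ∀ a → deleteAt b (λ a → f a * δ a b) a ≡ 0#
    off-b a with b ≟ a | a ≟ b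
    ... | yes _ | _     = refl
    ... | no b≢a | yes a≡b = contradiction (sym a≡b) b≢a
    ... | no _ | no _ = R.zeroʳ (f a)

  combination : ∀ {j n} → (Fin j → Fin n → Carrier) → (Fin j → Carrier) → Fin n → Carrier
  combination v c w = Σ[ (λ l → c l * v l w) ]

  combination-+ : ∀ {j n} (v : Fin j → Fin n → Carrier) c d w →
                  combination v (λ l → c l + d l) w ≡ combination v c w + combination v d w
  combination-+ v c d w =
    trans (Σ-cong (λ l → R.distribʳ (v l w) (c l) (d l))) (Σ-+ (λ l → c l * v l w) (λ l → d l * v l w))

  combination-* : ∀ {j n} (v : Fin j → Fin n → Carrier) k c w →
                  combination v (λ l → k * c l) w ≡ k * combination v c w
  combination-* v k c w = trans (Σ-cong (λ l → R.*-assoc k (c l) (v l w))) (Σ-*ˡ k (λ l → c l * v l w))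

  combination-0∷ : ∀ {j n} (v : Fin (suc j) → Fin n → Carrier) d w →
                   combination v (0# ∷ d) w ≡ combination (v ∘ suc) d w
  combination-0∷ v d w = trans (cong (_+ combination (v ∘ suc) d w) (R.zeroˡ _)) (R.+-identityˡ _)

  combination-combination : ∀ {i j n} (g : Fin i → Carrier) (h : Fin i → Fin j → Carrier)
                            (v : Fin j → Fin n → Carrier) w →
    combination v (λ l → Σ[ (λ a → g a * h a l) ]) w ≡ Σ[ (λ a → g a * combination v (h a) w) ]
  combination-combination g h v w = begin
    Σ[ (λ l → Σ[ (λ a → g a * h a l) ] * v l w) ]     ≡⟨ Σ-cong (λ l → sym (Σ-*ʳ (v l w) (λ a → g a * h a l))) ⟩
    Σ[ (λ l → Σ[ (λ a → g a * h a l * v l w) ]) ]     ≡⟨ Σ-cong (λ l → Σ-cong (λ a → R.*-assoc (g a) (h a l) (v l w))) ⟩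
    Σ[ (λ l → Σ[ (λ a → g a * (h a l * v l w)) ]) ]   ≡⟨ sym (Σ-swap (λ a l → g a * (h a l * v l w))) ⟩
    Σ[ (λ a → Σ[ (λ l → g a * (h a l * v l w)) ]) ]   ≡⟨ Σ-cong (λ a → Σ-*ˡ (g a) (λ l → h a l * v l w)) ⟩
    Σ[ (λ a → g a * combination v (h a) w) ]          ∎

  -- Double negation as a monad; used to run the classical steps of
  -- Gaussian elimination, whose final conclusions are ¬¬-stable equations.
  ¬¬-map : ∀ {A B : Set} → (A → B) → ¬ ¬ A → ¬ ¬ B
  ¬¬-map f ¬¬a ¬b = ¬¬a (¬b ∘ f)

  ¬¬-bind : ∀ {A B : Set} → ¬ ¬ A → (A → ¬ ¬ B) → ¬ ¬ B
  ¬¬-bind ¬¬a f ¬b = ¬¬a (λ a → f a ¬b)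

  module _ {n : ℕ} (S : Fin n → Set) where

    IndependentOn : ∀ {j} → (Fin j → Fin n → Carrier) → Set
    IndependentOn v = ∀ d → (∀ w → S w → combination v d w ≡ 0#) → ∀ l → d l ≡ 0#

    -- Positions in S together with combinations of v forming the dual
    -- basis at these positions (the outcome of Gaussian elimination).
    record DualSystem {j} (v : Fin j → Fin n → Carrier) : Set where
      field
        position  : Fin j → Fin n
        position∈ : ∀ a → S (position a)
        coeff     : Fin j → Fin j → Carrier
        dual      : ∀ a b → combination v (coeff a) (position b) ≡ δ a b

    -- One elimination step: given a dual system D for the tail of v,
    -- subtract from the head its components along D.
    module Elimination {j} (v : Fin (suc j) → Fin n → Carrier) (D : DualSystem (v ∘ suc)) where
      open DualSystem D

      component : Fin j → Carrier
      component a = v zero (position a)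

      residualCoeff : Fin (suc j) → Carrier
      residualCoeff = 1# ∷ λ l → - Σ[ (λ a → component a * coeff a l) ]

      residual : Fin n → Carrier
      residual = combination v residualCoeff

      residual-vanishes : ∀ b → residual (position b) ≡ 0#
      residual-vanishes b = begin
        1# * v zero p + Σ[ (λ l → - γ l * v (suc l) p) ]
          ≡⟨ cong (1# * v zero p +_) (Σ-cong (λ l → sym (-‿distribˡ-* (γ l) (v (suc l) p)))) ⟩
        1# * v zero p + Σ[ (λ l → - (γ l * v (suc l) p)) ]
          ≡⟨ cong (1# * v zero p +_) (Σ-neg (λ l → γ l * v (suc l) p)) ⟩
        1# * v zero p - combination (v ∘ suc) γ p
          ≡⟨ cong (λ x → 1# * v zero p - x) (combination-combination component coeff (v ∘ suc) p) ⟩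
        1# * v zero p - Σ[ (λ a → component a * combination (v ∘ suc) (coeff a) p) ]
          ≡⟨ cong (λ x → 1# * v zero p - x) (Σ-cong (λ a → cong (component a *_) (dual a b))) ⟩
        1# * v zero p - Σ[ (λ a → component a * δ a b) ]
          ≡⟨ cong (λ x → 1# * v zero p - x) (Σ-δ component b) ⟩
        1# * v zero p - v zero p
          ≡⟨ solve 1 (λ x → 𝟙 :* x :- x := 𝟘) refl (v zero p) ⟩
        0# ∎
        where
        p = position b
        γ : Fin j → Carrier
        γ l = Σ[ (λ a → component a * coeff a l) ]

      -- A position w ∈ S where the residual does not vanish extends D to v:
      -- the new first row is the normalised residual, and it is subtracted
      -- from the old rows to clear their entries at w.
      extend : ∀ w → S w → residual w ≢ 0# → DualSystem v
      extend w w∈S r≢0 = record { position = w ∷ position ; position∈ = pos∈ ; coeff = c ; dual = dual′ }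
        where
        ρ⁻¹ = residual w ⁻¹
        ρ⁻¹ρ : ρ⁻¹ * residual w ≡ 1#
        ρ⁻¹ρ = trans (R.*-comm _ _) (⁻¹-inverse _ r≢0)
        head-row : Fin (suc j) → Carrier
        head-row l = ρ⁻¹ * residualCoeff l
        head-row-value : ∀ x → combination v head-row x ≡ ρ⁻¹ * residual x
        head-row-value = combination-* v ρ⁻¹ residualCoeff
        κ : Fin j → Carrier
        κ a = combination (v ∘ suc) (coeff a) w
        tail-row : Fin j → Fin (suc j) → Carrier
        tail-row a l = (0# ∷ coeff a) l + (- κ a) * head-row l
        tail-row-value : ∀ a x → combination v (tail-row a) x ≡
                                 combination (v ∘ suc) (coeff a) x + (- κ a) * (ρ⁻¹ * residual x)
        tail-row-value a x = trans (combination-+ v (0# ∷ coeff a) (λ l → - κ a * head-row l) x)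
          (cong₂ _+_ (combination-0∷ v (coeff a) x)
                     (trans (combination-* v (- κ a) head-row x) (cong (- κ a *_) (head-row-value x))))
        pos∈ : ∀ a → S ((w ∷ position) a)
        pos∈ zero    = w∈S
        pos∈ (suc a) = position∈ a
        c : Fin (suc j) → Fin (suc j) → Carrier
        c = head-row ∷ tail-row
        dual′ : ∀ a b → combination v (c a) ((w ∷ position) b) ≡ δ a b
        dual′ zero zero       = trans (head-row-value w) ρ⁻¹ρ
        dual′ zero (suc b)    = trans (head-row-value (position b))
                                      (trans (cong (ρ⁻¹ *_) (residual-vanishes b)) (R.zeroʳ ρ⁻¹))
        dual′ (suc a) zero    = trans (tail-row-value a w)
          (trans (cong (λ x → κ a + - κ a * x) ρ⁻¹ρ) (solve 1 (λ k → k :+ :- k :* 𝟙 := 𝟘) refl (κ a)))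
        dual′ (suc a) (suc b) = trans (tail-row-value a (position b))
          (trans (cong₂ (λ x y → x + - κ a * (ρ⁻¹ * y)) (dual a b) (residual-vanishes b))
                 (solve 3 (λ d k r → d :+ :- k :* (r :* 𝟘) := d) refl (δ a b) (κ a) ρ⁻¹))

    -- Gaussian elimination: an independent family has a dual system.  The
    -- residual is a nontrivial combination, so by independence it cannot
    -- vanish on all of S.
    dual-system : ∀ {j} (v : Fin j → Fin n → Carrier) → IndependentOn v → ¬ ¬ DualSystem v
    dual-system {zero} v _ ¬D = ¬D (record { position = λ () ; position∈ = λ () ; coeff = λ () ; dual = λ () })
    dual-system {suc j} v indep =
      ¬¬-bind (dual-system (v ∘ suc) tail-indep) λ D →
        let open Elimination v D in
        ¬¬-map (λ (w , w∈S , r≢0) → extend w w∈S r≢0) (nonvanishing D)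
      where
      tail-indep : IndependentOn (v ∘ suc)
      tail-indep d d≡0 l = indep (0# ∷ d) (λ w w∈S → trans (combination-0∷ v d w) (d≡0 w w∈S)) (suc l)
      nonvanishing : ∀ D → ¬ ¬ (∃ λ w → S w × Elimination.residual v D w ≢ 0#)
      nonvanishing D ¬∃ = 0≢1 (sym (indep (Elimination.residualCoeff v D)
                                          (λ w w∈S → ≡-stable (λ r≢0 → ¬∃ (w , w∈S , r≢0))) zero))

  combination-eigenvector : ∀ {n k} (G : Graph n) μ (b : Fin k → Fin n → Carrier) →
    (∀ l → IsEigenvector G μ (b l)) → ∀ c → IsEigenvector G μ (combination b c)
  combination-eigenvector G μ b b-eig c i = begin
    Σ[ (λ j → A G i j * Σ[ (λ l → c l * b l j) ]) ]     ≡⟨ Σ-cong (λ j → sym (Σ-*ˡ (A G i j) (λ l → c l * b l j))) ⟩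
    Σ[ (λ j → Σ[ (λ l → A G i j * (c l * b l j)) ]) ]   ≡⟨ Σ-swap (λ j l → A G i j * (c l * b l j)) ⟩
    Σ[ (λ l → Σ[ (λ j → A G i j * (c l * b l j)) ]) ]   ≡⟨ Σ-cong (λ l → Σ-cong (λ j → exchange (A G i j) (c l) (b l j))) ⟩
    Σ[ (λ l → Σ[ (λ j → c l * (A G i j * b l j)) ]) ]   ≡⟨ Σ-cong (λ l → trans (Σ-*ˡ (c l) (λ j → A G i j * b l j)) (cong (c l *_) (b-eig l i))) ⟩
    Σ[ (λ l → c l * (μ * b l i)) ]                      ≡⟨ Σ-cong (λ l → exchange (c l) μ (b l i)) ⟩
    Σ[ (λ l → μ * (c l * b l i)) ]                      ≡⟨ Σ-*ˡ μ (λ l → c l * b l i) ⟩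
    μ * combination b c i                               ∎
    where
    exchange : ∀ x y z → x * (y * z) ≡ y * (x * z)
    exchange = solve 3 (λ x y z → x :* (y :* z) := y :* (x :* z)) refl

  -- The restriction of the μ-eigenspace to the
  -- coordinates in X is injective, hence (by dimension) bijective.
  module StarSet {n m : ℕ} (G : Graph n) (μ : Carrier) (X : Subset n) (e : Fin m → Fin n)
                 (enum : EnumeratesComplement X e) (μ∉H : ¬ IsEigenvalue (induced G e) μ) where

    e∉X : ∀ i → e i ∉ X
    e∉X i = Equivalence.from (proj₂ enum (e i)) (i , refl)

    missed∈X : ∀ w → (∀ i → e i ≢ w) → w ∈ X
    missed∈X w missed with w ∈? X
    ... | yes w∈X = w∈X
    ... | no w∉X  = let (i , eᵢ≡w) = Equivalence.to (proj₂ enum w) w∉X in contradiction eᵢ≡w (missed i)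

    Σ-vanishing-on-X : (f : Fin n → Carrier) → (∀ w → w ∈ X → f w ≡ 0#) → Σ[ f ] ≡ Σ[ f ∘ e ]
    Σ-vanishing-on-X f f≡0 = Σ-image e (proj₁ enum) f (λ w missed → f≡0 w (missed∈X w missed))

    Σ-vanishing-on-X-except : ∀ u → u ∈ X → (f : Fin n → Carrier) →
      (∀ w → w ∈ X → w ≢ u → f w ≡ 0#) → Σ[ f ] ≡ f u + Σ[ f ∘ e ]
    Σ-vanishing-on-X-except u u∈X f f≡0 =
      trans (Σ-deleteAt u f) (cong (f u +_) (trans (Σ-vanishing-on-X f′ f′≡0) (Σ-cong f′∘e)))
      where
      f′ = deleteAt u f
      f′≡0 : ∀ w → w ∈ X → f′ w ≡ 0#
      f′≡0 w w∈X with u ≟ w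
      ... | yes _   = refl
      ... | no u≢w = f≡0 w w∈X (u≢w ∘ sym)
      f′∘e : ∀ i → f′ (e i) ≡ f (e i)
      f′∘e i with u ≟ e i
      ... | yes u≡eᵢ = contradiction (subst (_∈ X) u≡eᵢ u∈X) (e∉X i)
      ... | no _     = refl

    -- A μ-eigenvector of G vanishing on X restricts to a μ-eigenvector of
    -- H, so it vanishes everywhere.
    vanishing-on-X : ∀ y → IsEigenvector G μ y → (∀ w → w ∈ X → y w ≡ 0#) → ∀ w → y w ≡ 0#
    vanishing-on-X y y-eig y≡0 w with w ∈? X
    ... | yes w∈X = y≡0 w w∈X
    ... | no w∉X  = let (i , eᵢ≡w) = Equivalence.to (proj₂ enum w) w∉X in
                    trans (cong y (sym eᵢ≡w)) (≡-stable (λ yeᵢ≢0 → μ∉H (y ∘ e , restricted , i , yeᵢ≢0)))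
      where
      restricted : IsEigenvector (induced G e) μ (y ∘ e)
      restricted i = trans (sym (Σ-vanishing-on-X (λ j → A G (e i) j * y j)
                                   (λ w w∈X → trans (cong (A G (e i) w *_) (y≡0 w w∈X)) (R.zeroʳ _))))
                           (y-eig (e i))

    StarVector : Fin n → Set
    StarVector u = Σ (Fin n → Carrier) λ y →
      IsEigenvector G μ y × y u ≡ 1# × (∀ w → w ∈ X → w ≢ u → y w ≡ 0#)

    -- Gaussian elimination on a basis of the eigenspace at the coordinates
    -- in X; its ∣ X ∣ positions exhaust X, and the dual row at u is the
    -- star vector.
    star-vector : Multiplicity G μ ∣ X ∣ → ∀ u → u ∈ X → ¬ ¬ StarVector u
    star-vector (b , b-eig , b-indep , _) u u∈X = ¬¬-map star-from-dual (dual-system (_∈ X) b indep)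
      where
      indep : IndependentOn (_∈ X) b
      indep d d≡0 = b-indep d (vanishing-on-X _ (combination-eigenvector G μ b b-eig d) d≡0)
      star-from-dual : DualSystem (_∈ X) b → StarVector u
      star-from-dual D = y , combination-eigenvector G μ b b-eig (coeff a) , y-u , y-X
        where
        open DualSystem D
        position-injective : Injective _≡_ _≡_ position
        position-injective {a} {a′} eq with a ≟ a′
        ... | yes a≡a′ = a≡a′
        ... | no a≢a′ = contradiction (trans (sym (δ-refl a)) (trans (sym (dual a a))
                          (trans (cong (combination b (coeff a)) eq) (trans (dual a a′) (δ-≢ a≢a′))))) 1≢0
          where 1≢0 = 0≢1 ∘ sym
        onto = injection-onto X position position-injective position∈
        a = proj₁ (onto u u∈X)
        y = combination b (coeff a)
        y-u : y u ≡ 1#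
        y-u = trans (cong y (sym (proj₂ (onto u u∈X)))) (trans (dual a a) (δ-refl a))
        y-X : ∀ w → w ∈ X → w ≢ u → y w ≡ 0#
        y-X w w∈X w≢u = let (a′ , pa′≡w) = onto w w∈X in
          trans (cong y (sym pa′≡w)) (trans (dual a a′)
                (δ-≢ (λ a≡a′ → w≢u (trans (sym pa′≡w) (trans (cong position (sym a≡a′)) (proj₂ (onto u u∈X)))))))

  by-blocks : ∀ s t (P : Fin (s +ℕ t) → Set) → (∀ a → P (a ↑ˡ t)) → (∀ b → P (s ↑ʳ b)) → ∀ i → P i
  by-blocks s t P left right i = subst P (join-splitAt s t i) (from-split (splitAt s i))
    where
    from-split : ∀ x → P (join s t x)
    from-split (inj₁ a) = left a
    from-split (inj₂ b) = right b

  module Join (s t : ℕ) where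

    Aᴶ : Fin (s +ℕ t) → Fin (s +ℕ t) → Carrier
    Aᴶ i j = if joinAdj s t i j then 1# else 0#

    cliqueSum cocliqueSum : (Fin (s +ℕ t) → Carrier) → Carrier
    cliqueSum   z = Σ[ (λ a → z (a ↑ˡ t)) ]
    cocliqueSum z = Σ[ (λ b → z (s ↑ʳ b)) ]

    row-clique : ∀ (z : Fin (s +ℕ t) → Carrier) a →
      Σ[ (λ j → Aᴶ (a ↑ˡ t) j * z j) ] ≡ (cliqueSum z - z (a ↑ˡ t)) + cocliqueSum z
    row-clique z a = begin
      Σ[ (λ j → Aᴶ (a ↑ˡ t) j * z j) ]              ≡⟨ Σ-split s _ ⟩
      Σ[ (λ b → Aᴶ (a ↑ˡ t) (b ↑ˡ t) * z (b ↑ˡ t)) ] + Σ[ (λ b → Aᴶ (a ↑ˡ t) (s ↑ʳ b) * z (s ↑ʳ b)) ]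
        ≡⟨ cong₂ _+_ (Σ-cong clique-entry) (Σ-cong coclique-entry) ⟩
      Σ[ deleteAt a (z ∘ (_↑ˡ t)) ] + cocliqueSum z
        ≡⟨ cong (_+ cocliqueSum z) (solve 2 (λ x r → r := (x :+ r) :- x) refl (z (a ↑ˡ t)) _) ⟩
      (z (a ↑ˡ t) + Σ[ deleteAt a (z ∘ (_↑ˡ t)) ] - z (a ↑ˡ t)) + cocliqueSum z
        ≡⟨ cong (λ x → (x - z (a ↑ˡ t)) + cocliqueSum z) (sym (Σ-deleteAt a (z ∘ (_↑ˡ t)))) ⟩
      (cliqueSum z - z (a ↑ˡ t)) + cocliqueSum z   ∎
      where
      clique-entry : ∀ b → Aᴶ (a ↑ˡ t) (b ↑ˡ t) * z (b ↑ˡ t) ≡ deleteAt a (z ∘ (_↑ˡ t)) b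
      clique-entry b rewrite splitAt-↑ˡ s a t | splitAt-↑ˡ s b t with a ≟ b
      ... | yes _ = R.zeroˡ _
      ... | no _  = R.*-identityˡ _
      coclique-entry : ∀ b → Aᴶ (a ↑ˡ t) (s ↑ʳ b) * z (s ↑ʳ b) ≡ z (s ↑ʳ b)
      coclique-entry b rewrite splitAt-↑ˡ s a t | splitAt-↑ʳ s t b = R.*-identityˡ _

    row-coclique : ∀ (z : Fin (s +ℕ t) → Carrier) b → Σ[ (λ j → Aᴶ (s ↑ʳ b) j * z j) ] ≡ cliqueSum z
    row-coclique z b = begin
      Σ[ (λ j → Aᴶ (s ↑ʳ b) j * z j) ]              ≡⟨ Σ-split s _ ⟩
      Σ[ (λ a → Aᴶ (s ↑ʳ b) (a ↑ˡ t) * z (a ↑ˡ t)) ] + Σ[ (λ c → Aᴶ (s ↑ʳ b) (s ↑ʳ c) * z (s ↑ʳ c)) ]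
        ≡⟨ cong₂ _+_ (Σ-cong clique-entry) (Σ-zero _ coclique-entry) ⟩
      cliqueSum z + 0#                             ≡⟨ R.+-identityʳ _ ⟩
      cliqueSum z                                  ∎
      where
      clique-entry : ∀ a → Aᴶ (s ↑ʳ b) (a ↑ˡ t) * z (a ↑ˡ t) ≡ z (a ↑ˡ t)
      clique-entry a rewrite splitAt-↑ʳ s t b | splitAt-↑ˡ s a t = R.*-identityˡ _
      coclique-entry : ∀ c → Aᴶ (s ↑ʳ b) (s ↑ʳ c) * z (s ↑ʳ c) ≡ 0#
      coclique-entry c rewrite splitAt-↑ʳ s t b | splitAt-↑ʳ s t c = R.zeroˡ _

    iso-adjacency : ∀ {n} (G : Graph n) (e : Fin (s +ℕ t) → Fin n) → IsIsoOnto G e (joinAdj s t) →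
                    ∀ i j → A (induced G e) i j ≡ Aᴶ i j
    iso-adjacency G e iso i j = cong (if_then 1# else 0#) (iso i j)

    -- For s ≥ 2, -1 is an eigenvalue of the join: take 1 and -1 on two
    -- clique vertices and 0 elsewhere.
    minus-one-eigenvalue : 2 ≤ s → ∀ {n} (G : Graph n) (e : Fin (s +ℕ t) → Fin n) →
                           IsIsoOnto G e (joinAdj s t) → IsEigenvalue (induced G e) (- 1#)
    minus-one-eigenvalue (s≤s (s≤s {n = s′} _)) G e iso = x , eigen , zero ↑ˡ t , x₀≢0
      where
      x-clique : Fin s → Carrier
      x-clique = 1# ∷ (- 1# ∷ λ _ → 0#)
      x : Fin (s +ℕ t) → Carrier
      x i = [ x-clique , (λ _ → 0#) ]′ (splitAt s i)
      x-left : ∀ a → x (a ↑ˡ t) ≡ x-clique a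
      x-left a = cong [ x-clique , (λ _ → 0#) ]′ (splitAt-↑ˡ s a t)
      x-right : ∀ b → x (s ↑ʳ b) ≡ 0#
      x-right b = cong [ x-clique , (λ _ → 0#) ]′ (splitAt-↑ʳ s t b)
      x₀≢0 : x (zero ↑ˡ t) ≢ 0#
      x₀≢0 x₀≡0 = 0≢1 (sym (trans (sym (x-left zero)) x₀≡0))
      clique-sum : cliqueSum x ≡ 0#
      clique-sum = trans (Σ-cong x-left)
        (trans (cong (λ r → 1# + (- 1# + r)) (Σ-zero {s′} (λ _ → 0#) (λ _ → refl)))
               (solve 0 (𝟙 :+ (:- 𝟙 :+ 𝟘) := 𝟘) refl))
      coclique-sum : cocliqueSum x ≡ 0#
      coclique-sum = Σ-zero _ x-right
      row : ∀ i → Σ[ (λ j → A (induced G e) i j * x j) ] ≡ Σ[ (λ j → Aᴶ i j * x j) ]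
      row i = Σ-cong (λ j → cong (_* x j) (iso-adjacency G e iso i j))
      eigen : IsEigenvector (induced G e) (- 1#) x
      eigen = by-blocks s t _ at-clique at-coclique
        where
        at-clique : ∀ a → Σ[ (λ j → A (induced G e) (a ↑ˡ t) j * x j) ] ≡ - 1# * x (a ↑ˡ t)
        at-clique a = begin
          Σ[ (λ j → A (induced G e) (a ↑ˡ t) j * x j) ] ≡⟨ row (a ↑ˡ t) ⟩
          Σ[ (λ j → Aᴶ (a ↑ˡ t) j * x j) ]            ≡⟨ row-clique x a ⟩
          (cliqueSum x - x (a ↑ˡ t)) + cocliqueSum x  ≡⟨ cong₂ (λ c d → (c - x (a ↑ˡ t)) + d) clique-sum coclique-sum ⟩
          (0# - x (a ↑ˡ t)) + 0#                      ≡⟨ solve 1 (λ v → (𝟘 :- v) :+ 𝟘 := :- 𝟙 :* v) refl (x (a ↑ˡ t)) ⟩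
          - 1# * x (a ↑ˡ t)                           ∎
        at-coclique : ∀ b → Σ[ (λ j → A (induced G e) (s ↑ʳ b) j * x j) ] ≡ - 1# * x (s ↑ʳ b)
        at-coclique b = begin
          Σ[ (λ j → A (induced G e) (s ↑ʳ b) j * x j) ] ≡⟨ row (s ↑ʳ b) ⟩
          Σ[ (λ j → Aᴶ (s ↑ʳ b) j * x j) ]            ≡⟨ row-coclique x b ⟩
          cliqueSum x                                 ≡⟨ clique-sum ⟩
          0#                                          ≡⟨ sym (R.zeroʳ (- 1#)) ⟩
          - 1# * 0#                                   ≡⟨ cong (- 1# *_) (sym (x-right b)) ⟩
          - 1# * x (s ↑ʳ b)                           ∎

  Quadratic : (S T μ a : Carrier) → Carrier
  Quadratic S T μ a =
    (T + μ) * a * a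
    + (T + ι 2 * μ - ι 2 * S * T - ι 2 * S * μ + T * μ + ι 2 * μ * μ) * a
    + μ - S * T - ι 2 * S * μ + S * S * T - ι 2 * S * μ * μ + S * S * μ
    + ι 3 * μ * μ + ι 3 * μ * μ * μ + μ * μ * μ * μ - S * T * μ

  numeral : ∀ {k} → ℕ → Poly k
  numeral zero    = 𝟘
  numeral (suc n) = 𝟙 :+ numeral n

  cancel-nonzero : ∀ {x y} → x ≢ 0# → x * y ≡ 0# → y ≡ 0#
  cancel-nonzero {x} {y} x≢0 xy≡0 = begin
    y                  ≡⟨ solve 3 (λ x x⁻¹ y → y := (x⁻¹ :* x) :* y :+ (𝟙 :- x :* x⁻¹) :* y) refl x (x ⁻¹) y ⟩
    (x ⁻¹ * x) * y + (1# - x * x ⁻¹) * y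
                       ≡⟨ cong₂ (λ p q → p + (1# - q) * y) (R.*-assoc _ _ _) (⁻¹-inverse x x≢0) ⟩
    x ⁻¹ * (x * y) + (1# - 1#) * y
                       ≡⟨ cong (λ p → x ⁻¹ * p + (1# - 1#) * y) xy≡0 ⟩
    x ⁻¹ * 0# + (1# - 1#) * y
                       ≡⟨ solve 2 (λ x⁻¹ y → x⁻¹ :* 𝟘 :+ (𝟙 :- 𝟙) :* y := 𝟘) refl (x ⁻¹) y ⟩
    0#                 ∎

  -- The elimination behind the theorem.  σK, σI are the sums of the star
  -- vector over the clique and the coclique of H, α, γ the numbers of
  -- neighbours of u there, and P, Q the sums of the star vector over the
  -- neighbours of u in the clique and in the coclique.  Since μ ≠ -1 we get
  -- P = 0, so μ = Q and μ² = γ(1 + σK); eliminating σK = (α - S)/(μ + 1)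
  -- and γ = -μ - (μ + T)σK gives the quadratic.
  quadratic-relation : ∀ S T μ α γ σK σI P Q → μ + 1# ≢ 0# →
    1# + (σK + σI) ≡ 0# →
    μ * σK ≡ α + ((S * σK - σK) + S * σI) →
    μ * σI ≡ γ + T * σK →
    μ * P ≡ α * (1# + (σK + σI)) - P →
    μ * Q ≡ γ * (1# + σK) →
    μ ≡ P + Q →
    Quadratic S T μ α ≡ 0#
  quadratic-relation S T μ α γ σK σI P Q D≢0 orthogonal summed-clique summed-coclique
                     weighted-clique weighted-coclique at-u = begin
    Quadratic S T μ α
      ≡⟨ cong (Quadratic S T μ) α≡ ⟩
    Quadratic S T μ (D * σK + S)
      ≡⟨ solve 5 (λ μ S T σ γ → let D = μ :+ 𝟙 ; a = D :* σ :+ S ; c₂ = numeral 2 ; c₃ = numeral 3 in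
           (T :+ μ) :* a :* a
           :+ (T :+ c₂ :* μ :- c₂ :* S :* T :- c₂ :* S :* μ :+ T :* μ :+ c₂ :* μ :* μ) :* a
           :+ μ :- S :* T :- c₂ :* S :* μ :+ S :* S :* T :- c₂ :* S :* μ :* μ :+ S :* S :* μ
           :+ c₃ :* μ :* μ :+ c₃ :* μ :* μ :* μ :+ μ :* μ :* μ :* μ :- S :* T :* μ
           := D :* D :* (μ :* μ :- γ :* (𝟙 :+ σ))
              :+ D :* D :* ((𝟙 :+ σ) :* (γ :- (μ :* (:- 𝟙 :- σ) :- T :* σ)))) refl μ S T σK γ ⟩
    D * D * (μ * μ - γ * (1# + σK)) + D * D * ((1# + σK) * (γ - (μ * (- 1# - σK) - T * σK)))
      ≡⟨ cong₂ (λ p q → D * D * p + D * D * ((1# + σK) * q)) μ²≡ γ≡ ⟩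
    D * D * 0# + D * D * ((1# + σK) * 0#)
      ≡⟨ solve 2 (λ D σ → D :* D :* 𝟘 :+ D :* D :* ((𝟙 :+ σ) :* 𝟘) := 𝟘) refl D σK ⟩
    0# ∎
    where
    D = μ + 1#
    σI≡ : σI ≡ - 1# - σK
    σI≡ = trans (solve 2 (λ a b → b := (𝟙 :+ (a :+ b)) :+ (:- 𝟙 :- a)) refl σK σI)
                (trans (cong (_+ (- 1# - σK)) orthogonal) (R.+-identityˡ _))
    α≡ : α ≡ D * σK + S
    α≡ = begin
      α                                                ≡⟨ solve 4 (λ α S σK σI → α := (α :+ ((S :* σK :- σK) :+ S :* σI)) :- ((S :* σK :- σK) :+ S :* σI)) refl α S σK σI ⟩
      (α + ((S * σK - σK) + S * σI)) - ((S * σK - σK) + S * σI)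
                                                       ≡⟨ cong (λ x → x - ((S * σK - σK) + S * σI)) (sym summed-clique) ⟩
      μ * σK - ((S * σK - σK) + S * σI)                ≡⟨ cong (λ x → μ * σK - ((S * σK - σK) + S * x)) σI≡ ⟩
      μ * σK - ((S * σK - σK) + S * (- 1# - σK))       ≡⟨ solve 3 (λ μ σ S → μ :* σ :- ((S :* σ :- σ) :+ S :* (:- 𝟙 :- σ)) := (μ :+ 𝟙) :* σ :+ S) refl μ σK S ⟩
      D * σK + S                                       ∎
    P≡0 : P ≡ 0#
    P≡0 = cancel-nonzero D≢0 (begin
      D * P                              ≡⟨ solve 2 (λ μ P → (μ :+ 𝟙) :* P := μ :* P :+ P) refl μ P ⟩
      μ * P + P                          ≡⟨ cong (_+ P) weighted-clique ⟩
      α * (1# + (σK + σI)) - P + P       ≡⟨ cong (λ x → α * x - P + P) orthogonal ⟩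
      α * 0# - P + P                     ≡⟨ solve 2 (λ α P → α :* 𝟘 :- P :+ P := 𝟘) refl α P ⟩
      0#                                 ∎)
    μ²≡ : μ * μ - γ * (1# + σK) ≡ 0#
    μ²≡ = begin
      μ * μ - γ * (1# + σK)              ≡⟨ cong (λ x → μ * x - γ * (1# + σK)) (trans at-u (trans (cong (_+ Q) P≡0) (R.+-identityˡ Q))) ⟩
      μ * Q - γ * (1# + σK)              ≡⟨ cong (_- γ * (1# + σK)) weighted-coclique ⟩
      γ * (1# + σK) - γ * (1# + σK)      ≡⟨ R.-‿inverseʳ _ ⟩
      0#                                 ∎
    γ≡ : γ - (μ * (- 1# - σK) - T * σK) ≡ 0#
    γ≡ = begin
      γ - (μ * (- 1# - σK) - T * σK)     ≡⟨ cong (λ x → γ - (μ * x - T * σK)) (sym σI≡) ⟩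
      γ - (μ * σI - T * σK)              ≡⟨ cong (λ x → γ - (x - T * σK)) summed-coclique ⟩
      γ - ((γ + T * σK) - T * σK)        ≡⟨ solve 2 (λ γ x → γ :- ((γ :+ x) :- x) := 𝟘) refl γ (T * σK) ⟩
      0#                                 ∎

  A-idempotent : ∀ {n} (G : Graph n) v w → A G v w * A G v w ≡ A G v w
  A-idempotent G v w with adj G v w
  ... | true  = R.*-identityˡ 1#
  ... | false = R.zeroˡ 0#

  module StarVectorRelations {n : ℕ} (G : Graph n) (μ : Carrier) (s t : ℕ) (X : Subset n)
      (e : Fin (s +ℕ t) → Fin n) (enum : EnumeratesComplement X e)
      (μ∉H : ¬ IsEigenvalue (induced G e) μ) (iso : IsIsoOnto G e (joinAdj s t))
      (u : Fin n) (u∈X : u ∈ X) (y : Fin n → Carrier) (y-eig : IsEigenvector G μ y)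
      (y-u : y u ≡ 1#) (y-X : ∀ w → w ∈ X → w ≢ u → y w ≡ 0#) where

    open StarSet G μ X e enum μ∉H
    open Join s t

    z : Fin (s +ℕ t) → Carrier
    z = y ∘ e

    β : Fin (s +ℕ t) → Carrier
    β i = A G u (e i)

    zK βK : Fin s → Carrier
    zK a = z (a ↑ˡ t)
    βK a = β (a ↑ˡ t)
    zI βI : Fin t → Carrier
    zI b = z (s ↑ʳ b)
    βI b = β (s ↑ʳ b)

    σK σI α γ P Q : Carrier
    σK = Σ[ zK ]
    σI = Σ[ zI ]
    α  = Σ[ βK ]
    γ  = Σ[ βI ]
    P  = Σ[ (λ a → βK a * zK a) ]
    Q  = Σ[ (λ b → βI b * zI b) ]

    row-sum : ∀ v → Σ[ (λ j → A G v j * y j) ] ≡ A G v u + Σ[ (λ i → A G v (e i) * z i) ]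
    row-sum v = begin
      Σ[ (λ j → A G v j * y j) ]      ≡⟨ Σ-vanishing-on-X-except u u∈X _ off-u ⟩
      A G v u * y u + rest            ≡⟨ cong (λ x → A G v u * x + rest) y-u ⟩
      A G v u * 1# + rest             ≡⟨ cong (_+ rest) (R.*-identityʳ _) ⟩
      A G v u + rest                  ∎
      where
      rest = Σ[ (λ i → A G v (e i) * z i) ]
      off-u : ∀ w → w ∈ X → w ≢ u → A G v w * y w ≡ 0#
      off-u w w∈X w≢u = trans (cong (A G v w *_) (y-X w w∈X w≢u)) (R.zeroʳ _)

    at-H : ∀ i → μ * z i ≡ β i + Σ[ (λ j → Aᴶ i j * z j) ]
    at-H i = begin
      μ * z i                                         ≡⟨ sym (y-eig (e i)) ⟩
      Σ[ (λ j → A G (e i) j * y j) ]                  ≡⟨ row-sum (e i) ⟩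
      A G (e i) u + Σ[ (λ j → A G (e i) (e j) * z j) ]
        ≡⟨ cong₂ _+_ (cong (if_then 1# else 0#) (Graph.sym G (e i) u))
                     (Σ-cong (λ j → cong (_* z j) (iso-adjacency G e iso i j))) ⟩
      β i + Σ[ (λ j → Aᴶ i j * z j) ]                 ∎

    at-clique : ∀ a → μ * zK a ≡ βK a + ((σK - zK a) + σI)
    at-clique a = trans (at-H (a ↑ˡ t)) (cong (β (a ↑ˡ t) +_) (row-clique z a))

    at-coclique : ∀ b → μ * zI b ≡ βI b + σK
    at-coclique b = trans (at-H (s ↑ʳ b)) (cong (β (s ↑ʳ b) +_) (row-coclique z b))

    at-u : μ ≡ P + Q
    at-u = begin
      μ                                               ≡⟨ sym (trans (cong (μ *_) y-u) (R.*-identityʳ μ)) ⟩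
      μ * y u                                         ≡⟨ sym (y-eig u) ⟩
      Σ[ (λ j → A G u j * y j) ]                      ≡⟨ row-sum u ⟩
      A G u u + Σ[ (λ i → β i * z i) ]                ≡⟨ cong (λ x → (if x then 1# else 0#) + Σ[ (λ i → β i * z i) ]) (irrefl G u) ⟩
      0# + Σ[ (λ i → β i * z i) ]                     ≡⟨ R.+-identityˡ _ ⟩
      Σ[ (λ i → β i * z i) ]                          ≡⟨ Σ-split s _ ⟩
      P + Q                                           ∎

    orthogonal : (∀ v → IsEigenvector G μ v → Σ[ v ] ≡ 0#) → 1# + (σK + σI) ≡ 0#
    orthogonal nonMain = begin
      1# + (σK + σI)       ≡⟨ cong₂ _+_ (sym y-u) (sym (Σ-split s z)) ⟩
      y u + Σ[ z ]         ≡⟨ sym (Σ-vanishing-on-X-except u u∈X y y-X) ⟩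
      Σ[ y ]               ≡⟨ nonMain y y-eig ⟩
      0#                   ∎

    summed-clique : μ * σK ≡ α + ((ι s * σK - σK) + ι s * σI)
    summed-clique = begin
      μ * σK                                                  ≡⟨ sym (Σ-*ˡ μ zK) ⟩
      Σ[ (λ a → μ * zK a) ]                                   ≡⟨ Σ-cong at-clique ⟩
      Σ[ (λ a → βK a + ((σK - zK a) + σI)) ]                  ≡⟨ Σ-+ βK (λ a → (σK - zK a) + σI) ⟩
      α + Σ[ (λ a → (σK - zK a) + σI) ]                       ≡⟨ cong (α +_) (Σ-+ (λ a → σK - zK a) (λ _ → σI)) ⟩
      α + (Σ[ (λ a → σK - zK a) ] + Σ[ (λ (_ : Fin s) → σI) ])
        ≡⟨ cong (λ x → α + (x + Σ[ (λ (_ : Fin s) → σI) ])) (Σ-+ (λ _ → σK) (λ a → - zK a)) ⟩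
      α + ((Σ[ (λ (_ : Fin s) → σK) ] + Σ[ (λ a → - zK a) ]) + Σ[ (λ (_ : Fin s) → σI) ])
        ≡⟨ cong₂ (λ x w → α + (x + w)) (cong₂ _+_ (Σ-const s σK) (Σ-neg zK)) (Σ-const s σI) ⟩
      α + ((ι s * σK - σK) + ι s * σI)                        ∎

    summed-coclique : μ * σI ≡ γ + ι t * σK
    summed-coclique = begin
      μ * σI                                  ≡⟨ sym (Σ-*ˡ μ zI) ⟩
      Σ[ (λ b → μ * zI b) ]                   ≡⟨ Σ-cong at-coclique ⟩
      Σ[ (λ b → βI b + σK) ]                  ≡⟨ Σ-+ βI (λ _ → σK) ⟩
      γ + Σ[ (λ (_ : Fin t) → σK) ]           ≡⟨ cong (γ +_) (Σ-const t σK) ⟩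
      γ + ι t * σK                            ∎

    -- An eigen-equation at a vertex of H multiplied by β i, using β i ² = β i.
    weighted-at : ∀ i {x} → μ * z i ≡ β i + x → μ * (β i * z i) ≡ β i * (1# + x)
    weighted-at i {x} eq = begin
      μ * (β i * z i)       ≡⟨ solve 3 (λ μ b z → μ :* (b :* z) := b :* (μ :* z)) refl μ (β i) (z i) ⟩
      β i * (μ * z i)       ≡⟨ cong (β i *_) eq ⟩
      β i * (β i + x)       ≡⟨ R.distribˡ _ _ _ ⟩
      β i * β i + β i * x   ≡⟨ cong (_+ β i * x) (A-idempotent G u (e i)) ⟩
      β i + β i * x         ≡⟨ solve 2 (λ b x → b :+ b :* x := b :* (𝟙 :+ x)) refl (β i) x ⟩
      β i * (1# + x)        ∎

    weighted-clique : μ * P ≡ α * (1# + (σK + σI)) - P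
    weighted-clique = begin
      μ * P                                                      ≡⟨ sym (Σ-*ˡ μ (λ a → βK a * zK a)) ⟩
      Σ[ (λ a → μ * (βK a * zK a)) ]                             ≡⟨ Σ-cong (λ a → trans (weighted-at (a ↑ˡ t) (at-clique a)) (regroup a)) ⟩
      Σ[ (λ a → βK a * (1# + (σK + σI)) + - (βK a * zK a)) ]     ≡⟨ Σ-+ (λ a → βK a * (1# + (σK + σI))) (λ a → - (βK a * zK a)) ⟩
      Σ[ (λ a → βK a * (1# + (σK + σI))) ] + Σ[ (λ a → - (βK a * zK a)) ]
                                                                 ≡⟨ cong₂ _+_ (Σ-*ʳ _ βK) (Σ-neg (λ a → βK a * zK a)) ⟩
      α * (1# + (σK + σI)) - P                                   ∎
      where
      regroup : ∀ a → βK a * (1# + ((σK - zK a) + σI)) ≡ βK a * (1# + (σK + σI)) + - (βK a * zK a)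
      regroup a = solve 4 (λ b k z i → b :* (𝟙 :+ ((k :- z) :+ i)) := b :* (𝟙 :+ (k :+ i)) :+ :- (b :* z))
                          refl (βK a) σK (zK a) σI

    weighted-coclique : μ * Q ≡ γ * (1# + σK)
    weighted-coclique = begin
      μ * Q                              ≡⟨ sym (Σ-*ˡ μ (λ b → βI b * zI b)) ⟩
      Σ[ (λ b → μ * (βI b * zI b)) ]     ≡⟨ Σ-cong (λ b → weighted-at (s ↑ʳ b) (at-coclique b)) ⟩
      Σ[ (λ b → βI b * (1# + σK)) ]      ≡⟨ Σ-*ʳ _ βI ⟩
      γ * (1# + σK)                      ∎

    relation : (∀ v → IsEigenvector G μ v → Σ[ v ] ≡ 0#) → μ + 1# ≢ 0# → Quadratic (ι s) (ι t) μ α ≡ 0#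
    relation nonMain μ+1≢0 = quadratic-relation (ι s) (ι t) μ α γ σK σI P Q μ+1≢0 (orthogonal nonMain)
      summed-clique summed-coclique weighted-clique weighted-coclique at-u

  -- A star complement K_s ∇ tK_1 with s ≥ 2 has eigenvalue -1, so μ ≠ -1.
  μ+1≢0 : ∀ {n} s t → 2 ≤ s → (G : Graph n) (e : Fin (s +ℕ t) → Fin n) →
          IsIsoOnto G e (joinAdj s t) → ∀ μ → ¬ IsEigenvalue (induced G e) μ → μ + 1# ≢ 0#
  μ+1≢0 s t 2≤s G e iso μ μ∉H μ+1≡0 =
    μ∉H (subst (IsEigenvalue (induced G e)) (sym μ≡-1) (Join.minus-one-eigenvalue s t 2≤s G e iso))
    where
    μ≡-1 : μ ≡ - 1#
    μ≡-1 = begin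
      μ               ≡⟨ solve 1 (λ μ → μ := (μ :+ 𝟙) :- 𝟙) refl μ ⟩
      (μ + 1#) - 1#   ≡⟨ cong (_- 1#) μ+1≡0 ⟩
      0# - 1#         ≡⟨ R.+-identityˡ _ ⟩
      - 1#            ∎

  ι-+ : ∀ m n → ι (m +ℕ n) ≡ ι m + ι n
  ι-+ zero    n = sym (R.+-identityˡ _)
  ι-+ (suc m) n = trans (cong (1# +_) (ι-+ m n)) (sym (R.+-assoc _ _ _))

  ι-degree : ∀ {k} (adjacent : Fin k → Bool) →
             ι (sumℕ (λ w → indicator (adjacent w))) ≡ Σ[ (λ w → if adjacent w then 1# else 0#) ]
  ι-degree {zero}  adjacent = refl
  ι-degree {suc k} adjacent = trans (ι-+ (indicator (adjacent zero)) _)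
                                    (cong₂ _+_ (entry (adjacent zero)) (ι-degree (adjacent ∘ suc)))
    where
    entry : ∀ b → ι (indicator b) ≡ (if b then 1# else 0#)
    entry true  = R.+-identityʳ 1#
    entry false = refl

lemma3p1 : (ℝ : RealField) → let open Spectral ℝ in
    (s t : ℕ) → 2 ≤ s → 2 ≤ t →
    {n : ℕ} (G : Graph n) (r : ℕ) → Regular G r →
    (μ : Carrier) → NonMain G μ →
    (X : Subset n) → IsStarSet G μ X →
    (e : Fin (s +ℕ t) → Fin n) → EnumeratesComplement X e →
    IsIsoOnto G e (joinAdj s t) →
    (u : Fin n) → u ∈ X →
    let a = ι (sumℕ (λ w → indicator (adj G u (e (w ↑ˡ t)))))
        S = ι s
        T = ι t
    in (T + μ) * a * a
       + (T + ι 2 * μ - ι 2 * S * T - ι 2 * S * μ + T * μ + ι 2 * μ * μ) * a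
       + μ - S * T - ι 2 * S * μ + S * S * T - ι 2 * S * μ * μ + S * S * μ
       + ι 3 * μ * μ + ι 3 * μ * μ * μ + μ * μ * μ * μ - S * T * μ
       ≡ 0#
lemma3p1 ℝ s t 2≤s _ G _ _ μ (_ , nonMain) X (multiplicity , star-complement) e enum iso u u∈X =
  ≡-stable (¬¬-map relation-for (star-vector multiplicity u u∈X))
  where
  open Spectral ℝ
  open Theory ℝ
  μ∉H : ¬ IsEigenvalue (induced G e) μ
  μ∉H = star-complement _ e enum
  open StarSet G μ X e enum μ∉H
  -- The star vector at u, known to exist only under ¬¬, yields the
  -- relation; the relation is an equation and hence ¬¬-stable.
  relation-for : StarVector u → Quadratic (ι s) (ι t) μ (ι (sumℕ (λ w → indicator (adj G u (e (w ↑ˡ t)))))) ≡ 0#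
  relation-for (y , y-eig , y-u , y-X) =
    subst (λ a → Quadratic (ι s) (ι t) μ a ≡ 0#) (sym (ι-degree (λ w → adj G u (e (w ↑ˡ t)))))
          (relation nonMain (μ+1≢0 s t 2≤s G e iso μ μ∉H))
    where open StarVectorRelations G μ s t X e enum μ∉H iso u u∈X y y-eig y-u y-X
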